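{- Let $n \ge 1$, let $N = \{0,\dots,2n-1\}$, and let $G = (N, w)$ be a closed integer octagonal graph. Define $G_{\mathrm T} = (N, w_{\mathrm T})$ by, for all $i,j \in N$, \[ w_{\mathrm T}(i,j) := \min\Bigl\{ w(i,j),\ \Bigl\lfloor \tfrac{w(i,\bar\imath)}{2}\Bigr\rfloor + \Bigl\lfloor \tfrac{w(\bar\jmath,j)}{2}\Bigr\rfloor \Bigr\}. \] If $G_{\mathrm T}$ is an octagonal graph, then $G_{\mathrm T} = \mathrm{T\text{ - }closure}(G)$.
   Context: Weights lie in $\mathbb{Q}_\infty = \mathbb{Q}\cup\{+\infty\}$ with $d<+\infty$ for all $d\in\mathbb{Q}$; $\lfloor +\infty/2\rfloor = +\infty$ and $+\infty + d = +\infty$. A graph on a finite node set $N$ is a pair $(N,w)$ with $w : N\times N \to \mathbb{Q}_\infty$; $(a,b)$ is an arc if $w(a,b)<+\infty$. A path is a finite nonempty sequence of nodes consecutive pairs of which are arcs; its weight is the sum of the arc weights. A graph is consistent if it has no cycle of negative weight (equivalently the system $\{a - b \le w(a,b)\}$ is satisfiable over $\mathbb{Q}$). For graphs on the same node set, $(N,w_1) \unlhd (N,w_2)$ iff $w_1(a,b)\le w_2(a,b)$ for all $a,b$. A consistent graph is closed if $w(a,a)=0$ for all $a$ and $w(a,b)\le w(a,c)+w(c,b)$ for all $a,b,c$. For $i \in N=\{0,\dots,2n-1\}$, $\bar\imath = i+1$ if $i$ is even and $\bar\imath = i-1$ if $i$ is odd. An octagonal graph is a consistent graph $(N,w)$ with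 $w(i,j) = w(\bar\jmath,\bar\imath)$ for all $i,j\in N$. It is an integer octagonal graph if moreover all weights lie in $\mathbb{Z}\cup\{+\infty\}$. An octagonal graph is strongly closed if it is closed and $2w(i,j) \le w(i,\bar\imath) + w(\bar\jmath,j)$ for all $i,j$. It is tightly closed if it is a strongly closed integer octagonal graph and $w(i,\bar\imath)$ is even for every $i$ (with $+\infty$ counted as allowed). The tight closure $\mathrm{T\text{ - }closure}(G)$ is the least upper bound (pointwise maximum of weight functions) of the set of all tightly closed octagonal graphs $G' \unlhd G$, in the lattice of octagonal graphs augmented with a bottom element $\bot$ (inconsistency); the least upper bound of the empty set is $\bot$. -}

module Defs where

open import Data.Nat using (ℕ; zero; suc)
open import Data.Integer using (ℤ) renaming (_+_ to _+ℤ_)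
open import Data.Rational using (ℚ; 0ℚ; floor; ½) renaming (_+_ to _+ℚ_; _*_ to _*ℚ_; _≤_ to _≤ℚ_; _/_ to _/ℚ_; _≤?_ to _≤?ℚ_)
open import Data.Fin using (Fin; zero; suc)
open import Data.List using (List; []; _∷_; _++_; [_])
open import Relation.Nullary using (yes; no)
open import Data.Maybe using (Maybe; just; nothing)
open import Data.Product using (_×_; ∃)
open import Data.Unit using (⊤)
open import Data.Empty using (⊥)
open import Relation.Binary.PropositionalEquality using (_≡_)

data ℚ∞ : Set where
  fin : ℚ → ℚ∞
  +∞  : ℚ∞

data _≤∞_ : ℚ∞ → ℚ∞ → Set where
  fin≤fin : ∀ {p q} → p ≤ℚ q → fin p ≤∞ fin q
  _≤+∞    : ∀ x → x ≤∞ +∞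

infix 4 _≤∞_
infixl 6 _⊕_

_⊕_ : ℚ∞ → ℚ∞ → ℚ∞
fin p ⊕ fin q = fin (p +ℚ q)
fin p ⊕ +∞    = +∞
+∞    ⊕ _     = +∞

ℤ→ℚ : ℤ → ℚ
ℤ→ℚ z = z /ℚ 1

min∞ : ℚ∞ → ℚ∞ → ℚ∞
min∞ (fin p) (fin q) with p ≤?ℚ q
... | yes _ = fin p
... | no _  = fin q
min∞ (fin p) +∞ = fin p
min∞ +∞ y = y

halfFloor : ℚ∞ → ℚ∞
halfFloor (fin q) = fin (ℤ→ℚ (floor (q *ℚ ½)))
halfFloor +∞      = +∞

IsInt∞ : ℚ∞ → Set
IsInt∞ (fin q) = ∃ λ (z : ℤ) → q ≡ ℤ→ℚ z
IsInt∞ +∞      = ⊤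

IsEven∞ : ℚ∞ → Set
IsEven∞ (fin q) = ∃ λ (z : ℤ) → q ≡ ℤ→ℚ (z +ℤ z)
IsEven∞ +∞      = ⊤

Graph : ℕ → Set
Graph k = Fin k → Fin k → ℚ∞

-- ī : 2m ↦ 2m+1, 2m+1 ↦ 2m (used with k = 2n)
bar : ∀ {k} → Fin k → Fin k
bar {suc zero}    zero          = zero
bar {suc (suc k)} zero          = suc zero
bar {suc (suc k)} (suc zero)    = zero
bar {suc (suc k)} (suc (suc i)) = suc (suc (bar i))

-- weight of the path (sequence of nodes) a ∷ l; +∞ iff some consecutive
-- pair is not an arc (so only genuine paths get finite weight)
pathWeight : ∀ {k} → Graph k → Fin k → List (Fin k) → ℚ∞
pathWeight w a []      = fin 0ℚ
pathWeight w a (b ∷ l) = w a b ⊕ pathWeight w b l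

Consistent : ∀ {k} → Graph k → Set
Consistent w = ∀ a l → fin 0ℚ ≤∞ pathWeight w a (l ++ [ a ])

_⊴_ : ∀ {k} → Graph k → Graph k → Set
w₁ ⊴ w₂ = ∀ a b → w₁ a b ≤∞ w₂ a b

Closed : ∀ {k} → Graph k → Set
Closed w = Consistent w × (∀ a → w a a ≡ fin 0ℚ)
         × (∀ a b c → w a b ≤∞ w a c ⊕ w c b)

Octagonal : ∀ {k} → Graph k → Set
Octagonal w = Consistent w × (∀ i j → w i j ≡ w (bar j) (bar i))

IntegerOctagonal : ∀ {k} → Graph k → Set
IntegerOctagonal w = Octagonal w × (∀ i j → IsInt∞ (w i j))

StronglyClosed : ∀ {k} → Graph k → Set
StronglyClosed w = Octagonal w × Closed w
  × (∀ i j → w i j ⊕ w i j ≤∞ w i (bar i) ⊕ w (bar j) j)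

TightlyClosed : ∀ {k} → Graph k → Set
TightlyClosed w = StronglyClosed w × IntegerOctagonal w
  × (∀ i → IsEven∞ (w i (bar i)))

-- lattice of octagonal graphs augmented with bottom: nothing = ⊥
AugElem : ∀ {k} → Maybe (Graph k) → Set
AugElem nothing  = ⊤
AugElem (just w) = Octagonal w

_⊴⊥_ : ∀ {k} → Maybe (Graph k) → Maybe (Graph k) → Set
nothing ⊴⊥ _       = ⊤
just _  ⊴⊥ nothing = ⊥
just a  ⊴⊥ just b  = a ⊴ b

TUpperBound : ∀ {k} → Graph k → Maybe (Graph k) → Set
TUpperBound w X = ∀ w' → TightlyClosed w' → w' ⊴ w → just w' ⊴⊥ X

IsTClosure : ∀ {k} → Graph k → Maybe (Graph k) → Set
IsTClosure w X = AugElem X × TUpperBound w X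
  × (∀ Y → AugElem Y → TUpperBound w Y → X ⊴⊥ Y)

wT : ∀ {k} → Graph k → Graph k
wT w i j = min∞ (w i j) (halfFloor (w i (bar i)) ⊕ halfFloor (w (bar j) j))

module Submission where

-- Write T = wT w, i.e. T(i,j) = min (w(i,j)) (⌊w(i,ī)/2⌋ + ⌊w(j̄,j)/2⌋).
-- Since ⌊w(i,ī)/2⌋ + ⌊w(i,ī)/2⌋ ≤ w(i,ī), the diagonal pairs become
-- T(i,ī) = 2⌊w(i,ī)/2⌋, which are even.  Using this, T is shown to be
-- tightly closed: it is integral, its strong-closure inequality holds by
-- construction, and both T(a,a) = 0 and the triangle inequality (a
-- four-case estimate) rest only on the closure of w and on the nonnegativity
-- ⌊w(c,c̄)/2⌋ + ⌊w(c̄,c)/2⌋ ≥ 0, read off from the consistency of T on the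
-- 2-cycle c → c̄ → c.  Conversely every tightly
-- closed G' ⊴ G satisfies 2w'(i,j) ≤ w'(i,ī) + w'(j̄,j) with even integer
-- summands bounded by w(i,ī), w(j̄,j), so w' ⊴ T.  Thus T is the greatest
-- tightly closed graph below G, hence the least upper bound of that set.

open import Defs
open import Data.Nat as ℕ using (ℕ; _≤_; _*_)
open import Data.Maybe using (just)
open import Data.Integer as ℤ using (ℤ; +_; +[1+_])
import Data.Integer.Properties as ℤP
import Data.Integer.DivMod as ℤD
open import Data.Integer.Tactic.RingSolver using (solve-∀)
open import Data.Rational as ℚ using (ℚ; mkℚ; floor; ½; 0ℚ)
import Data.Rational.Properties as ℚP
import Data.Nat.Coprimality as ℕC
open import Data.Fin using (Fin; zero; suc)
open import Data.List using ([]; _∷_)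
open import Data.Product using (_,_; proj₁; proj₂)
open import Data.Sum using (_⊎_; inj₁; inj₂)
open import Data.Unit using (tt)
open import Relation.Binary.PropositionalEquality
open import Relation.Nullary using (yes; no)

ℤ→ℚ-mkℚ : ∀ z → ℤ→ℚ z ≡ mkℚ z 0 (ℕC.sym (ℕC.1-coprimeTo ℤ.∣ z ∣))
ℤ→ℚ-mkℚ z = ℚP.↥p/↧p≡p (mkℚ z 0 _)

ℤ→ℚ-+ : ∀ a b → ℤ→ℚ a ℚ.+ ℤ→ℚ b ≡ ℤ→ℚ (a ℤ.+ b)
ℤ→ℚ-+ a b = begin
  ℤ→ℚ a ℚ.+ ℤ→ℚ b                 ≡⟨ cong₂ ℚ._+_ (ℤ→ℚ-mkℚ a) (ℤ→ℚ-mkℚ b) ⟩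
  ℤ→ℚ (a ℤ.* + 1 ℤ.+ b ℤ.* + 1)   ≡⟨ cong ℤ→ℚ (cong₂ ℤ._+_ (ℤP.*-identityʳ a) (ℤP.*-identityʳ b)) ⟩
  ℤ→ℚ (a ℤ.+ b)                   ∎
  where open ≡-Reasoning

ℤ→ℚ-mono-≤ : ∀ {a b} → a ℤ.≤ b → ℤ→ℚ a ℚ.≤ ℤ→ℚ b
ℤ→ℚ-mono-≤ {a} {b} a≤b rewrite ℤ→ℚ-mkℚ a | ℤ→ℚ-mkℚ b =
  ℚ.*≤* (ℤP.*-monoʳ-≤-nonNeg (+ 1) a≤b)

ℤ→ℚ-cancel-≤ : ∀ {a b} → ℤ→ℚ a ℚ.≤ ℤ→ℚ b → a ℤ.≤ b
ℤ→ℚ-cancel-≤ {a} {b} le rewrite ℤ→ℚ-mkℚ a | ℤ→ℚ-mkℚ b =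
  subst₂ ℤ._≤_ (ℤP.*-identityʳ a) (ℤP.*-identityʳ b) (ℚP.drop-*≤* le)

floor-≤ : ∀ p → ℤ→ℚ (floor p) ℚ.≤ p
floor-≤ p@(mkℚ n d _) rewrite ℤ→ℚ-mkℚ (floor p) =
  ℚ.*≤* (subst (floor p ℤ.* +[1+ d ] ℤ.≤_) (sym (ℤP.*-identityʳ n))
                (ℤD.[n/d]*d≤n n +[1+ d ]))

floor-greatest : ∀ z p → ℤ→ℚ z ℚ.≤ p → z ℤ.≤ floor p
floor-greatest z p@(mkℚ n d _) z≤p = ℤP.≮⇒≥ λ q<z →
  ℤP.<⇒≱ n<[q+1]d (ℤP.≤-trans (ℤP.*-monoʳ-≤-nonNeg +[1+ d ] (ℤP.i<j⇒suc[i]≤j q<z)) zd≤n)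
  where
  q = floor p
  zd≤n : z ℤ.* +[1+ d ] ℤ.≤ n
  zd≤n rewrite ℤ→ℚ-mkℚ z = subst (z ℤ.* +[1+ d ] ℤ.≤_) (ℤP.*-identityʳ n) (ℚP.drop-*≤* z≤p)
  n<[q+1]d : n ℤ.< ℤ.suc q ℤ.* +[1+ d ]
  n<[q+1]d = subst (λ r → n ℤ.< ℤ.suc r ℤ.* +[1+ d ])
                   (sym (ℤD.div-pos-is-/ℕ n (ℕ.suc d))) (ℤD.n<s[n/ℕd]*d n (ℕ.suc d))

halves-sum : ∀ q → q ℚ.* ½ ℚ.+ q ℚ.* ½ ≡ q
halves-sum q = trans (sym (ℚP.*-distribˡ-+ q ½ ½)) (ℚP.*-identityʳ q)

≤-half⇒double-≤ : ∀ p q → p ℚ.≤ q ℚ.* ½ → p ℚ.+ p ℚ.≤ q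
≤-half⇒double-≤ p q le = subst (p ℚ.+ p ℚ.≤_) (halves-sum q) (ℚP.+-mono-≤ le le)

cancel-double-ℚ : ∀ p q → p ℚ.+ p ℚ.≤ q ℚ.+ q → p ℚ.≤ q
cancel-double-ℚ p q le = ℚP.≮⇒≥ λ q<p →
  ℚP.<-irrefl refl (ℚP.<-≤-trans (ℚP.+-mono-< q<p q<p) le)

half : ℤ → ℤ
half z = floor (ℤ→ℚ z ℚ.* ½)

≤-half : ∀ a z → a ℤ.+ a ℤ.≤ z → a ℤ.≤ half z
≤-half a z le = floor-greatest a _ (cancel-double-ℚ (ℤ→ℚ a) (ℤ→ℚ z ℚ.* ½)
  (subst₂ ℚ._≤_ (sym (ℤ→ℚ-+ a a)) (sym (halves-sum (ℤ→ℚ z))) (ℤ→ℚ-mono-≤ le)))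

half-double-≤ : ∀ z → half z ℤ.+ half z ℤ.≤ z
half-double-≤ z = ℤ→ℚ-cancel-≤ (subst (ℚ._≤ ℤ→ℚ z) (ℤ→ℚ-+ (half z) (half z))
  (≤-half⇒double-≤ _ _ (floor-≤ (ℤ→ℚ z ℚ.* ½))))

-- Halving a bound that traverses an extra weight b twice costs b once.
half-shift : ∀ x y b → x ℤ.≤ b ℤ.+ (y ℤ.+ b) → half x ℤ.≤ half y ℤ.+ b
half-shift x y b le = subst (ℤ._≤ half y ℤ.+ b) (sym (minus-plus (half x) b))
                            (ℤP.+-monoˡ-≤ b (≤-half m y m+m≤y))
  where
  m = half x ℤ.- b
  double-minus : ∀ h b → (h ℤ.- b) ℤ.+ (h ℤ.- b) ≡ (h ℤ.+ h) ℤ.+ ℤ.- (b ℤ.+ b)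
  double-minus = solve-∀
  cancel-b : ∀ b y → (b ℤ.+ (y ℤ.+ b)) ℤ.+ ℤ.- (b ℤ.+ b) ≡ y
  cancel-b = solve-∀
  minus-plus : ∀ h b → h ≡ (h ℤ.- b) ℤ.+ b
  minus-plus = solve-∀
  m+m≤y : m ℤ.+ m ℤ.≤ y
  m+m≤y = subst₂ ℤ._≤_ (sym (double-minus (half x) b)) (cancel-b b y)
            (ℤP.+-monoˡ-≤ (ℤ.- (b ℤ.+ b)) (ℤP.≤-trans (half-double-≤ x) le))

≤∞-refl : ∀ {x} → x ≤∞ x
≤∞-refl {fin p} = fin≤fin ℚP.≤-refl
≤∞-refl {+∞}    = +∞ ≤+∞

≤∞-reflexive : ∀ {x y} → x ≡ y → x ≤∞ y
≤∞-reflexive refl = ≤∞-refl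

≤∞-trans : ∀ {x y z} → x ≤∞ y → y ≤∞ z → x ≤∞ z
≤∞-trans (fin≤fin p≤q) (fin≤fin q≤r) = fin≤fin (ℚP.≤-trans p≤q q≤r)
≤∞-trans _             (_ ≤+∞)       = _ ≤+∞

≤∞-antisym : ∀ {x y} → x ≤∞ y → y ≤∞ x → x ≡ y
≤∞-antisym (fin≤fin p≤q) (fin≤fin q≤p) = cong fin (ℚP.≤-antisym p≤q q≤p)
≤∞-antisym (_ ≤+∞)       (_ ≤+∞)       = refl

⊕-mono : ∀ {a b c d} → a ≤∞ b → c ≤∞ d → a ⊕ c ≤∞ b ⊕ d
⊕-mono (fin≤fin a≤b) (fin≤fin c≤d) = fin≤fin (ℚP.+-mono-≤ a≤b c≤d)
⊕-mono (fin≤fin _)   (_ ≤+∞)       = _ ≤+∞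
⊕-mono (_ ≤+∞)       _             = _ ≤+∞

⊕-comm : ∀ a b → a ⊕ b ≡ b ⊕ a
⊕-comm (fin p) (fin q) = cong fin (ℚP.+-comm p q)
⊕-comm (fin p) +∞      = refl
⊕-comm +∞      (fin q) = refl
⊕-comm +∞      +∞      = refl

⊕-assoc : ∀ a b c → (a ⊕ b) ⊕ c ≡ a ⊕ (b ⊕ c)
⊕-assoc (fin p) (fin q) (fin r) = cong fin (ℚP.+-assoc p q r)
⊕-assoc (fin p) (fin q) +∞      = refl
⊕-assoc (fin p) +∞      c       = refl
⊕-assoc +∞      b       c       = refl

⊕-identityʳ : ∀ a → a ⊕ fin 0ℚ ≡ a
⊕-identityʳ (fin p) = cong fin (ℚP.+-identityʳ p)
⊕-identityʳ +∞      = refl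

⊕-interchange : ∀ a b c d → (a ⊕ b) ⊕ (c ⊕ d) ≡ (a ⊕ c) ⊕ (b ⊕ d)
⊕-interchange a b c d = begin
  (a ⊕ b) ⊕ (c ⊕ d) ≡⟨ ⊕-assoc a b (c ⊕ d) ⟩
  a ⊕ (b ⊕ (c ⊕ d)) ≡⟨ cong (a ⊕_) (sym (⊕-assoc b c d)) ⟩
  a ⊕ ((b ⊕ c) ⊕ d) ≡⟨ cong (λ t → a ⊕ (t ⊕ d)) (⊕-comm b c) ⟩
  a ⊕ ((c ⊕ b) ⊕ d) ≡⟨ cong (a ⊕_) (⊕-assoc c b d) ⟩
  a ⊕ (c ⊕ (b ⊕ d)) ≡⟨ sym (⊕-assoc a c (b ⊕ d)) ⟩
  (a ⊕ c) ⊕ (b ⊕ d) ∎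
  where open ≡-Reasoning

≤-⊕-nonneg : ∀ a t → fin 0ℚ ≤∞ t → a ≤∞ a ⊕ t
≤-⊕-nonneg a t 0≤t = subst (_≤∞ a ⊕ t) (⊕-identityʳ a) (⊕-mono (≤∞-refl {a}) 0≤t)

cancel-double : ∀ x y → x ⊕ x ≤∞ y ⊕ y → x ≤∞ y
cancel-double (fin p) (fin q) (fin≤fin le) = fin≤fin (cancel-double-ℚ p q le)
cancel-double x       +∞      _            = _ ≤+∞
cancel-double +∞      (fin q) ()

min∞-sel : ∀ x y → min∞ x y ≡ x ⊎ min∞ x y ≡ y
min∞-sel (fin p) (fin q) with p ℚ.≤? q
... | yes _ = inj₁ refl
... | no _  = inj₂ refl
min∞-sel (fin p) +∞ = inj₁ refl
min∞-sel +∞      y  = inj₂ refl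

min∞-≤ˡ : ∀ x y → min∞ x y ≤∞ x
min∞-≤ˡ (fin p) (fin q) with p ℚ.≤? q
... | yes _   = ≤∞-refl
... | no p≰q  = fin≤fin (ℚP.<⇒≤ (ℚP.≰⇒> p≰q))
min∞-≤ˡ (fin p) +∞ = ≤∞-refl
min∞-≤ˡ +∞      y  = _ ≤+∞

min∞-≤ʳ : ∀ x y → min∞ x y ≤∞ y
min∞-≤ʳ (fin p) (fin q) with p ℚ.≤? q
... | yes p≤q = fin≤fin p≤q
... | no _    = ≤∞-refl
min∞-≤ʳ (fin p) +∞ = _ ≤+∞
min∞-≤ʳ +∞      y  = ≤∞-refl

min∞-greatest : ∀ {z x y} → z ≤∞ x → z ≤∞ y → z ≤∞ min∞ x y
min∞-greatest {z} {x} {y} z≤x z≤y with min∞-sel x y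
... | inj₁ e = subst (z ≤∞_) (sym e) z≤x
... | inj₂ e = subst (z ≤∞_) (sym e) z≤y

min∞-eqˡ : ∀ x y → x ≤∞ y → min∞ x y ≡ x
min∞-eqˡ x y x≤y = ≤∞-antisym (min∞-≤ˡ x y) (min∞-greatest ≤∞-refl x≤y)

min∞-eqʳ : ∀ x y → y ≤∞ x → min∞ x y ≡ y
min∞-eqʳ x y y≤x = ≤∞-antisym (min∞-≤ʳ x y) (min∞-greatest y≤x ≤∞-refl)

≤-min∞⊕min∞ : ∀ {z x₁ x₂ y₁ y₂} → z ≤∞ x₁ ⊕ y₁ → z ≤∞ x₁ ⊕ y₂
  → z ≤∞ x₂ ⊕ y₁ → z ≤∞ x₂ ⊕ y₂ → z ≤∞ min∞ x₁ x₂ ⊕ min∞ y₁ y₂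
≤-min∞⊕min∞ {z} {x₁} {x₂} {y₁} {y₂} h₁₁ h₁₂ h₂₁ h₂₂
  with min∞-sel x₁ x₂ | min∞-sel y₁ y₂
... | inj₁ ex | inj₁ ey rewrite ex | ey = h₁₁
... | inj₁ ex | inj₂ ey rewrite ex | ey = h₁₂
... | inj₂ ex | inj₁ ey rewrite ex | ey = h₂₁
... | inj₂ ex | inj₂ ey rewrite ex | ey = h₂₂

halfFloor-int : ∀ x → IsInt∞ (halfFloor x)
halfFloor-int (fin q) = floor (q ℚ.* ½) , refl
halfFloor-int +∞      = tt

⊕-int : ∀ x y → IsInt∞ x → IsInt∞ y → IsInt∞ (x ⊕ y)
⊕-int (fin _) (fin _) (a , refl) (b , refl) = a ℤ.+ b , ℤ→ℚ-+ a b
⊕-int (fin _) +∞      _          _          = tt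
⊕-int +∞      _       _          _          = tt

min∞-int : ∀ x y → IsInt∞ x → IsInt∞ y → IsInt∞ (min∞ x y)
min∞-int x y ix iy with min∞-sel x y
... | inj₁ e = subst IsInt∞ (sym e) ix
... | inj₂ e = subst IsInt∞ (sym e) iy

halfFloor-double-even : ∀ x → IsEven∞ (halfFloor x ⊕ halfFloor x)
halfFloor-double-even (fin q) = h , ℤ→ℚ-+ h h where h = floor (q ℚ.* ½)
halfFloor-double-even +∞      = tt

halfFloor-double-≤ : ∀ x → IsInt∞ x → halfFloor x ⊕ halfFloor x ≤∞ x
halfFloor-double-≤ (fin _) (z , refl) =
  fin≤fin (subst (ℚ._≤ ℤ→ℚ z) (sym (ℤ→ℚ-+ (half z) (half z))) (ℤ→ℚ-mono-≤ (half-double-≤ z)))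
halfFloor-double-≤ +∞      _          = _ ≤+∞

even-≤-halfFloor-double : ∀ e x → IsEven∞ e → IsInt∞ x → e ≤∞ x
  → e ≤∞ halfFloor x ⊕ halfFloor x
even-≤-halfFloor-double (fin _) (fin _) (a , refl) (z , refl) (fin≤fin le) =
  fin≤fin (subst (ℤ→ℚ (a ℤ.+ a) ℚ.≤_) (sym (ℤ→ℚ-+ (half z) (half z)))
    (ℤ→ℚ-mono-≤ (ℤP.+-mono-≤ a≤half a≤half)))
  where a≤half = ≤-half a z (ℤ→ℚ-cancel-≤ le)
even-≤-halfFloor-double e +∞ _ _ _ = _ ≤+∞

halfFloor-shift : ∀ x y b → IsInt∞ x → IsInt∞ y → IsInt∞ b
  → x ≤∞ b ⊕ (y ⊕ b) → halfFloor x ≤∞ halfFloor y ⊕ b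
halfFloor-shift (fin _) (fin _) (fin _) (x , refl) (y , refl) (b , refl) (fin≤fin le) =
  fin≤fin (subst (ℤ→ℚ (half x) ℚ.≤_) (sym (ℤ→ℚ-+ (half y) b))
    (ℤ→ℚ-mono-≤ (half-shift x y b (ℤ→ℚ-cancel-≤ (subst (ℤ→ℚ x ℚ.≤_) path-weight le)))))
  where
  path-weight : ℤ→ℚ b ℚ.+ (ℤ→ℚ y ℚ.+ ℤ→ℚ b) ≡ ℤ→ℚ (b ℤ.+ (y ℤ.+ b))
  path-weight = trans (cong (ℤ→ℚ b ℚ.+_) (ℤ→ℚ-+ y b)) (ℤ→ℚ-+ b (y ℤ.+ b))
halfFloor-shift x       (fin _) +∞      _ _ _ _  = _ ≤+∞
halfFloor-shift x       +∞      b       _ _ _ _  = _ ≤+∞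
halfFloor-shift +∞      (fin _) (fin _) _ _ _ ()

bar-involutive : ∀ {k} (i : Fin k) → bar (bar i) ≡ i
bar-involutive {ℕ.suc ℕ.zero}     zero          = refl
bar-involutive {ℕ.suc (ℕ.suc k)} zero          = refl
bar-involutive {ℕ.suc (ℕ.suc k)} (suc zero)    = refl
bar-involutive {ℕ.suc (ℕ.suc k)} (suc (suc i)) = cong (λ x → suc (suc x)) (bar-involutive i)

module OneStepTightening {k} (w : Graph k) (closed : Closed w)
  (intOct : IntegerOctagonal w) (octT : Octagonal (wT w)) where

  private
    T : Graph k
    T = wT w

    hf : ℚ∞ → ℚ∞
    hf = halfFloor

  triangle : ∀ a b c → w a b ≤∞ w a c ⊕ w c b
  triangle = proj₂ (proj₂ closed)

  coherent : ∀ i j → w i j ≡ w (bar j) (bar i)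
  coherent = proj₂ (proj₁ intOct)

  integral : ∀ i j → IsInt∞ (w i j)
  integral = proj₂ intOct

  T-pair : ∀ i → T i (bar i) ≡ hf (w i (bar i)) ⊕ hf (w i (bar i))
  T-pair i = trans
    (cong (λ j → min∞ (w i (bar i)) (hf (w i (bar i)) ⊕ hf (w j (bar i)))) (bar-involutive i))
    (min∞-eqʳ _ _ (halfFloor-double-≤ _ (integral i (bar i))))

  T-pair′ : ∀ i → T (bar i) i ≡ hf (w (bar i) i) ⊕ hf (w (bar i) i)
  T-pair′ i = subst (λ j → T (bar i) j ≡ hf (w (bar i) j) ⊕ hf (w (bar i) j))
                    (bar-involutive i) (T-pair (bar i))

  -- Consistency of T on the 2-cycle c → c̄ → c.
  halves-nonneg : ∀ c → fin 0ℚ ≤∞ hf (w c (bar c)) ⊕ hf (w (bar c) c)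
  halves-nonneg c = cancel-double (fin 0ℚ) (u ⊕ v)
    (subst (fin 0ℚ ≤∞_) cycle-weight (proj₁ octT c (bar c ∷ [])))
    where
    u = hf (w c (bar c))
    v = hf (w (bar c) c)
    cycle-weight : T c (bar c) ⊕ (T (bar c) c ⊕ fin 0ℚ) ≡ (u ⊕ v) ⊕ (u ⊕ v)
    cycle-weight = begin
      T c (bar c) ⊕ (T (bar c) c ⊕ fin 0ℚ) ≡⟨ cong (T c (bar c) ⊕_) (⊕-identityʳ _) ⟩
      T c (bar c) ⊕ T (bar c) c            ≡⟨ cong₂ _⊕_ (T-pair c) (T-pair′ c) ⟩
      (u ⊕ u) ⊕ (v ⊕ v)                    ≡⟨ ⊕-interchange u u v v ⟩
      (u ⊕ v) ⊕ (u ⊕ v)                    ∎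
      where open ≡-Reasoning

  half-via-left : ∀ a c → hf (w a (bar a)) ≤∞ w a c ⊕ hf (w c (bar c))
  half-via-left a c = subst (hf (w a (bar a)) ≤∞_) (⊕-comm _ _)
    (halfFloor-shift _ _ _ (integral a (bar a)) (integral c (bar c)) (integral a c)
      (≤∞-trans (triangle a (bar a) c) (⊕-mono (≤∞-refl {w a c})
        (≤∞-trans (triangle c (bar a) (bar c))
                  (⊕-mono (≤∞-refl {w c (bar c)}) (≤∞-reflexive (sym (coherent a c))))))))

  half-via-right : ∀ b c → hf (w (bar b) b) ≤∞ hf (w (bar c) c) ⊕ w c b
  half-via-right b c =
    halfFloor-shift _ _ _ (integral (bar b) b) (integral (bar c) c) (integral c b)
      (≤∞-trans (triangle (bar b) b (bar c))
        (⊕-mono (≤∞-reflexive (sym (coherent c b))) (triangle (bar c) b c)))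

  T-triangle : ∀ a b c → T a b ≤∞ T a c ⊕ T c b
  T-triangle a b c = ≤-min∞⊕min∞
    (≤∞-trans (min∞-≤ˡ _ _) (triangle a b c))
    (≤∞-trans (min∞-≤ʳ (w a b) _)
      (≤∞-trans (⊕-mono (half-via-left a c) (≤∞-refl {hf (w (bar b) b)}))
                (≤∞-reflexive (⊕-assoc (w a c) _ _))))
    (≤∞-trans (min∞-≤ʳ (w a b) _)
      (≤∞-trans (⊕-mono (≤∞-refl {hf (w a (bar a))}) (half-via-right b c))
                (≤∞-reflexive (sym (⊕-assoc _ _ (w c b))))))
    (≤∞-trans (min∞-≤ʳ (w a b) _)
      (≤∞-trans (≤-⊕-nonneg _ _ (subst (fin 0ℚ ≤∞_) (⊕-comm _ _) (halves-nonneg c)))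
                (≤∞-reflexive (rearrange (hf (w a (bar a))) (hf (w (bar b) b))
                                         (hf (w (bar c) c)) (hf (w c (bar c)))))))
    where
    rearrange : ∀ x y z t → (x ⊕ y) ⊕ (z ⊕ t) ≡ (x ⊕ z) ⊕ (t ⊕ y)
    rearrange x y z t = trans (⊕-interchange x y z t) (cong ((x ⊕ z) ⊕_) (⊕-comm y t))

  T-diagonal : ∀ a → T a a ≡ fin 0ℚ
  T-diagonal a rewrite proj₁ (proj₂ closed) a = min∞-eqˡ _ _ (halves-nonneg a)

  T-strong : ∀ i j → T i j ⊕ T i j ≤∞ T i (bar i) ⊕ T (bar j) j
  T-strong i j = ≤∞-trans (⊕-mono (min∞-≤ʳ (w i j) _) (min∞-≤ʳ (w i j) _))
    (≤∞-reflexive (trans (⊕-interchange _ _ _ _)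
      (sym (cong₂ _⊕_ (T-pair i) (T-pair′ j)))))

  T-int : ∀ a b → IsInt∞ (T a b)
  T-int a b = min∞-int _ _ (integral a b) (⊕-int _ _ (halfFloor-int _) (halfFloor-int _))

  T-even : ∀ i → IsEven∞ (T i (bar i))
  T-even i rewrite T-pair i = halfFloor-double-even (w i (bar i))

  T-tightlyClosed : TightlyClosed T
  T-tightlyClosed = (octT , (proj₁ octT , T-diagonal , T-triangle) , T-strong)
                  , (octT , T-int) , T-even

  T-below : T ⊴ w
  T-below a b = min∞-≤ˡ _ _

  -- Every tightly closed w' ⊴ w lies below T: 2w'(i,j) ≤ w'(i,ī) + w'(j̄,j)
  -- and each summand is an even integer bounded by the matching entry of w.
  T-upperBound : TUpperBound w (just T)
  T-upperBound w' ((_ , _ , strong′) , (_ , int′) , even′) w′≤w i j =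
    min∞-greatest (w′≤w i j) (cancel-double _ _ (≤∞-trans (strong′ i j) (≤∞-trans
      (⊕-mono (even-≤-halfFloor-double _ _ (even′ i) (integral i (bar i)) (w′≤w i (bar i)))
              (even-≤-halfFloor-double _ _ even-j (integral (bar j) j) (w′≤w (bar j) j)))
      (≤∞-reflexive (sym (⊕-interchange _ _ _ _))))))
    where
    even-j : IsEven∞ (w' (bar j) j)
    even-j = subst (λ x → IsEven∞ (w' (bar j) x)) (bar-involutive j) (even′ (bar j))

  -- T belongs to the set it bounds, so it is below every upper bound.
  T-least : ∀ Y → AugElem Y → TUpperBound w Y → just T ⊴⊥ Y
  T-least Y _ ub = ub T T-tightlyClosed T-below

theorem2 : (n : ℕ) → 1 ≤ n → (w : Graph (2 * n))
    → Closed w → IntegerOctagonal w → Octagonal (wT w)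
    → IsTClosure w (just (wT w))
theorem2 n _ w closed intOct octT = octT , T-upperBound , T-least
  where open OneStepTightening w closed intOct octT
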